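{- Let $\beta_k=\sum_{j=0}^{k}\binom{k}{j}^2\binom{k+j}{j}$. For any positive integer $n$, \[\sum_{k=0}^{n-1}(11k^2+13k+4)\beta_k=-\sum_{k=0}^{n-1}\binom{n}{k+1}^2\binom{n+k}{k}a_1(n,k),\] \[\sum_{k=0}^{n-1}(11k^2+9k+2)(-1)^{n-1-k}\beta_k=\sum_{k=0}^{n-1}\binom{n}{k+1}^2\binom{n+k}{k}a_2(n,k),\] \[\sum_{k=0}^{n-1}(11k^3+7k^2-1)(-1)^{n-1-k}\beta_k=\sum_{k=0}^{n-1}\binom{n}{k+1}^2\binom{n+k}{k}a_3(n,k),\] where $a_1(n,k)=n^3-n^2k-nk^2-2n^2-5nk+k^2-4n+2k+1$, $a_2(n,k)=n(3n-k-1)$, $a_3(n,k)=4n^3-2n^2k-nk^2-4n^2-3nk+k^2-2n+2k+1$. -}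

module Defs where

open import Data.Nat as ℕ using (ℕ; zero; suc)
open import Data.Nat.Combinatorics using (_C_)
open import Data.Integer using (ℤ; +_; _+_; _-_; _*_; -_; 0ℤ; 1ℤ)

sumTo : ℕ → (ℕ → ℤ) → ℤ
sumTo zero    f = 0ℤ
sumTo (suc n) f = sumTo n f + f n

sgn : ℕ → ℤ
sgn zero    = 1ℤ
sgn (suc m) = - sgn m

β : ℕ → ℤ
β k = sumTo (suc k) (λ j → + ((k C j) ℕ.* (k C j) ℕ.* ((k ℕ.+ j) C j)))

w : ℕ → ℕ → ℤ
w n k = + ((n C suc k) ℕ.* (n C suc k) ℕ.* ((n ℕ.+ k) C k))

a₁ : ℕ → ℕ → ℤ
a₁ n' k' = n * n * n - n * n * k - n * k * k - + 2 * n * n - + 5 * n * k + k * k - + 4 * n + + 2 * k + 1ℤ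
  where n = + n' ; k = + k'

a₂ : ℕ → ℕ → ℤ
a₂ n' k' = n * (+ 3 * n - k - 1ℤ)
  where n = + n' ; k = + k'

a₃ : ℕ → ℕ → ℤ
a₃ n' k' = + 4 * n * n * n - + 2 * n * n * k - n * k * k - + 4 * n * n - + 3 * n * k + k * k - + 2 * n + + 2 * k + 1ℤ
  where n = + n' ; k = + k'

{-# OPTIONS --safe #-}
-- WZ method. Put T(n,k) = C(n,k)² C(n+k,k), so β n = Σ_{k≤n} T(n,k), and u(n,k) = w(n,k) a(n,k).
-- With the certificate G(n,k) = P(n,k) T(n,k) each identity rests on the pointwise relation
--   u(n,k) + ε u(n+1,k) = c(n) T(n,k) + G(n,k+1) − G(n,k)          (ε = −1 for a₁, ε = 1 for a₂, a₃).
-- Since u(n,n) = G(n,0) = G(n,n+1) = 0, summing over k ≤ n gives S(n) + ε S(n+1) = c(n) β n for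
-- S(n) = Σ_{k<n} u(n,k), and this first-order recurrence with S(0) = 0 is solved by the left-hand
-- sides. All terms of the pointwise relation are rational multiples of T(n,k), so dividing by it
-- leaves a polynomial identity in n and k.
module Submission where

open import Defs
open import Data.Nat as ℕ using (ℕ; zero; suc; _∸_; _>_; _<_; s≤s)
import Data.Nat.Properties as ℕₚ
open import Data.Nat.Combinatorics using (_C_; nCk+nC[k+1]≡[n+1]C[k+1]; k>n⇒nCk≡0; nC1≡n)
open import Data.Integer using (ℤ; +_; _+_; _-_; _*_; -_; 0ℤ; 1ℤ)
import Data.Integer.Properties as ℤₚ
open import Data.Integer.Tactic.RingSolver using (solve-∀; solve)
open import Algebra.Properties.CommutativeSemigroup ℤₚ.+-commutativeSemigroup using (interchange)
open import Data.List using (_∷_; [])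
open import Data.Product using (_×_; _,_)
open import Relation.Binary.PropositionalEquality
  using (_≡_; refl; sym; trans; cong; cong₂; module ≡-Reasoning)
open ≡-Reasoning

sumTo-cong : ∀ n {f g : ℕ → ℤ} → (∀ {k} → k < n → f k ≡ g k) → sumTo n f ≡ sumTo n g
sumTo-cong zero    f≡g = refl
sumTo-cong (suc n) f≡g =
  cong₂ _+_ (sumTo-cong n (λ k<n → f≡g (ℕₚ.m<n⇒m<1+n k<n))) (f≡g (ℕₚ.n<1+n n))

sumTo-distrib-+ : ∀ n (f g : ℕ → ℤ) → sumTo n (λ k → f k + g k) ≡ sumTo n f + sumTo n g
sumTo-distrib-+ zero    f g = refl
sumTo-distrib-+ (suc n) f g =
  trans (cong (_+ (f n + g n)) (sumTo-distrib-+ n f g)) (interchange (sumTo n f) (sumTo n g) (f n) (g n))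

sumTo-*ˡ : ∀ n c (f : ℕ → ℤ) → sumTo n (λ k → c * f k) ≡ c * sumTo n f
sumTo-*ˡ zero    c f = sym (ℤₚ.*-zeroʳ c)
sumTo-*ˡ (suc n) c f =
  trans (cong (_+ c * f n) (sumTo-*ˡ n c f)) (sym (ℤₚ.*-distribˡ-+ c (sumTo n f) (f n)))

sumTo-telescope : ∀ n (g : ℕ → ℤ) → sumTo n (λ k → g (suc k) - g k) ≡ g n - g 0
sumTo-telescope zero    g = sym (ℤₚ.+-inverseʳ (g 0))
sumTo-telescope (suc n) g =
  trans (cong (_+ (g (suc n) - g n)) (sumTo-telescope n g)) (step (g 0) (g n) (g (suc n)))
  where
  step : ∀ x y z → (y - x) + (z - y) ≡ z - x
  step = solve-∀

sumTo-neg : ∀ n (f : ℕ → ℤ) → sumTo n (λ k → - f k) ≡ - sumTo n f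
sumTo-neg zero    f = refl
sumTo-neg (suc n) f =
  trans (cong (_+ - f n) (sumTo-neg n f)) (sym (ℤₚ.neg-distrib-+ (sumTo n f) (f n)))

sgn[n∸k]≡-sgn[n∸1∸k] : ∀ {n k} → k < n → sgn (n ∸ k) ≡ - sgn (n ∸ 1 ∸ k)
sgn[n∸k]≡-sgn[n∸1∸k] {suc n} (s≤s k≤n) = cong sgn (ℕₚ.+-∸-assoc 1 k≤n)

alternating-sumTo-suc : ∀ n (c b : ℕ → ℤ) →
  sumTo (suc n) (λ k → c k * sgn (suc n ∸ 1 ∸ k) * b k)
    ≡ - sumTo n (λ k → c k * sgn (n ∸ 1 ∸ k) * b k) + c n * b n
alternating-sumTo-suc n c b = cong₂ _+_ earlier-terms last-term
  where
  flip-sign : ∀ x s y → x * - s * y ≡ - (x * s * y)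
  flip-sign = solve-∀
  earlier-terms : sumTo n (λ k → c k * sgn (n ∸ k) * b k) ≡ - sumTo n (λ k → c k * sgn (n ∸ 1 ∸ k) * b k)
  earlier-terms = trans
    (sumTo-cong n (λ {k} k<n →
      trans (cong (λ s → c k * s * b k) (sgn[n∸k]≡-sgn[n∸1∸k] k<n)) (flip-sign (c k) (sgn (n ∸ 1 ∸ k)) (b k))))
    (sumTo-neg n (λ k → c k * sgn (n ∸ 1 ∸ k) * b k))
  last-term : c n * sgn (n ∸ n) * b n ≡ c n * b n
  last-term = trans (cong (λ m → c n * sgn m * b n) (ℕₚ.n∸n≡0 n)) (cong (_* b n) (ℤₚ.*-identityʳ (c n)))

sumTo-of-differences : ∀ (S f : ℕ → ℤ) → S 0 ≡ 0ℤ →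
  (∀ n → S n + - 1ℤ * S (suc n) ≡ f n) → ∀ n → sumTo n f ≡ - S n
sumTo-of-differences S f S₀≡0 rec zero    = sym (cong -_ S₀≡0)
sumTo-of-differences S f S₀≡0 rec (suc n) = begin
  sumTo n f + f n                   ≡⟨ cong₂ _+_ (sumTo-of-differences S f S₀≡0 rec n) (sym (rec n)) ⟩
  - S n + (S n + - 1ℤ * S (suc n))  ≡⟨ cancel (S n) (S (suc n)) ⟩
  - S (suc n)                       ∎
  where
  cancel : ∀ x y → - x + (x + - 1ℤ * y) ≡ - y
  cancel = solve-∀

alternating-sumTo-of-sums : ∀ (S c b : ℕ → ℤ) → S 0 ≡ 0ℤ →
  (∀ n → S n + 1ℤ * S (suc n) ≡ c n * b n) →
  ∀ n → sumTo n (λ k → c k * sgn (n ∸ 1 ∸ k) * b k) ≡ S n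
alternating-sumTo-of-sums S c b S₀≡0 rec zero    = sym S₀≡0
alternating-sumTo-of-sums S c b S₀≡0 rec (suc n) = begin
  sumTo (suc n) (λ k → c k * sgn (suc n ∸ 1 ∸ k) * b k)  ≡⟨ alternating-sumTo-suc n c b ⟩
  - sumTo n (λ k → c k * sgn (n ∸ 1 ∸ k) * b k) + c n * b n
    ≡⟨ cong₂ (λ x y → - x + y) (alternating-sumTo-of-sums S c b S₀≡0 rec n) (sym (rec n)) ⟩
  - S n + (S n + 1ℤ * S (suc n))                          ≡⟨ cancel (S n) (S (suc n)) ⟩
  S (suc n)                                               ∎
  where
  cancel : ∀ x y → - x + (x + 1ℤ * y) ≡ y
  cancel = solve-∀

[k+1]*[n+1]C[k+1]≡[n+1]*nCk : ∀ n k → suc k ℕ.* (suc n C suc k) ≡ suc n ℕ.* (n C k)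
[k+1]*[n+1]C[k+1]≡[n+1]*nCk zero    zero    = refl
[k+1]*[n+1]C[k+1]≡[n+1]*nCk zero    (suc k) = ℕₚ.*-zeroʳ (suc (suc k))
[k+1]*[n+1]C[k+1]≡[n+1]*nCk (suc n) zero    =
  trans (ℕₚ.*-identityˡ _) (trans (nC1≡n (suc (suc n))) (sym (ℕₚ.*-identityʳ (suc (suc n)))))
[k+1]*[n+1]C[k+1]≡[n+1]*nCk (suc n) (suc k) = begin
  suc (suc k) ℕ.* (suc (suc n) C suc (suc k))
    ≡⟨ cong (suc (suc k) ℕ.*_) (nCk+nC[k+1]≡[n+1]C[k+1] (suc n) (suc k)) ⟨
  suc (suc k) ℕ.* (c ℕ.+ d)
    ≡⟨ ℕₚ.*-distribˡ-+ (suc (suc k)) c d ⟩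
  (c ℕ.+ suc k ℕ.* c) ℕ.+ suc (suc k) ℕ.* d
    ≡⟨ cong₂ (λ x y → (c ℕ.+ x) ℕ.+ y) ([k+1]*[n+1]C[k+1]≡[n+1]*nCk n k) ([k+1]*[n+1]C[k+1]≡[n+1]*nCk n (suc k)) ⟩
  (c ℕ.+ suc n ℕ.* a) ℕ.+ suc n ℕ.* b
    ≡⟨ ℕₚ.+-assoc c _ _ ⟩
  c ℕ.+ (suc n ℕ.* a ℕ.+ suc n ℕ.* b)
    ≡⟨ cong (c ℕ.+_) (ℕₚ.*-distribˡ-+ (suc n) a b) ⟨
  c ℕ.+ suc n ℕ.* (a ℕ.+ b)
    ≡⟨ cong (λ x → c ℕ.+ suc n ℕ.* x) (nCk+nC[k+1]≡[n+1]C[k+1] n k) ⟩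
  suc (suc n) ℕ.* c
    ∎
  where
  a = n C k
  b = n C suc k
  c = suc n C suc k
  d = suc n C suc (suc k)

pos-*³ : ∀ x y z → + (x ℕ.* y ℕ.* z) ≡ + x * + y * + z
pos-*³ x y z = trans (ℤₚ.pos-* (x ℕ.* y) z) (cong (_* + z) (ℤₚ.pos-* x y))

pascal : ∀ n k → + (n C k) + + (n C suc k) ≡ + (suc n C suc k)
pascal n k = trans (sym (ℤₚ.pos-+ (n C k) (n C suc k))) (cong +_ (nCk+nC[k+1]≡[n+1]C[k+1] n k))

absorption : ∀ n k → + suc k * + (suc n C suc k) ≡ + suc n * + (n C k)
absorption n k = begin
  + suc k * + (suc n C suc k)    ≡⟨ ℤₚ.pos-* (suc k) (suc n C suc k) ⟨
  + (suc k ℕ.* (suc n C suc k))  ≡⟨ cong +_ ([k+1]*[n+1]C[k+1]≡[n+1]*nCk n k) ⟩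
  + (suc n ℕ.* (n C k))          ≡⟨ ℤₚ.pos-* (suc n) (n C k) ⟩
  + suc n * + (n C k)            ∎

[k+1]*nC[k+1]≡[n-k]*nCk : ∀ n k → + suc k * + (n C suc k) ≡ (+ n - + k) * + (n C k)
[k+1]*nC[k+1]≡[n-k]*nCk n k =
  shift (+ n) (+ k) (+ (n C k)) (+ (n C suc k)) (trans (cong (+ suc k *_) (pascal n k)) (absorption n k))
  where
  shift : ∀ n k a b → (1ℤ + k) * (a + b) ≡ (1ℤ + n) * a → (1ℤ + k) * b ≡ (n - k) * a
  shift n k a b eq = begin
    (1ℤ + k) * b                   ≡⟨ solve (k ∷ a ∷ b ∷ []) ⟩
    (1ℤ + k) * (a + b) - (1ℤ + k) * a  ≡⟨ cong (_- (1ℤ + k) * a) eq ⟩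
    (1ℤ + n) * a - (1ℤ + k) * a    ≡⟨ solve (n ∷ k ∷ a ∷ []) ⟩
    (n - k) * a                    ∎

[m+1-k]*[m+1]Ck≡[m+1]*mCk : ∀ m k → (+ suc m - + k) * + (suc m C k) ≡ + suc m * + (m C k)
[m+1-k]*[m+1]Ck≡[m+1]*mCk m k =
  shift (+ m) (+ k) (+ (suc m C k)) (+ (suc m C suc k)) (+ (m C k))
    (absorption m k)
    (trans (cong (+ suc k *_) (pascal (suc m) k)) (absorption (suc m) k))
  where
  shift : ∀ m k f e d → (1ℤ + k) * e ≡ (1ℤ + m) * d → (1ℤ + k) * (f + e) ≡ (1ℤ + (1ℤ + m)) * f →
          (1ℤ + m - k) * f ≡ (1ℤ + m) * d
  shift m k f e d h₁ h₂ = begin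
    (1ℤ + m - k) * f                    ≡⟨ solve (m ∷ k ∷ f ∷ []) ⟩
    (1ℤ + (1ℤ + m)) * f - (1ℤ + k) * f  ≡⟨ cong (_- (1ℤ + k) * f) (sym h₂) ⟩
    (1ℤ + k) * (f + e) - (1ℤ + k) * f   ≡⟨ solve (k ∷ f ∷ e ∷ []) ⟩
    (1ℤ + k) * e                        ≡⟨ h₁ ⟩
    (1ℤ + m) * d                        ∎

-- β n is sumTo (suc n) (T n) definitionally.
T : ℕ → ℕ → ℤ
T n k = + ((n C k) ℕ.* (n C k) ℕ.* ((n ℕ.+ k) C k))

T-above-diagonal : ∀ n → T n (suc n) ≡ 0ℤ
T-above-diagonal n = cong (λ c → + (c ℕ.* c ℕ.* ((n ℕ.+ suc n) C suc n))) (k>n⇒nCk≡0 (ℕₚ.n<1+n n))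

w-diagonal : ∀ n → w n n ≡ 0ℤ
w-diagonal n = cong (λ c → + (c ℕ.* c ℕ.* ((n ℕ.+ n) C n))) (k>n⇒nCk≡0 (ℕₚ.n<1+n n))

w-ratio : ∀ n k → + suc k * + suc k * w n k ≡ (+ n - + k) * (+ n - + k) * T n k
w-ratio n k = begin
  K * K * w n k                ≡⟨ cong (K * K *_) (pos-*³ b b d) ⟩
  K * K * (+ b * + b * + d)    ≡⟨ squared K δ (+ a) (+ b) (+ d) ([k+1]*nC[k+1]≡[n-k]*nCk n k) ⟩
  δ * δ * (+ a * + a * + d)    ≡⟨ cong (δ * δ *_) (sym (pos-*³ a a d)) ⟩
  δ * δ * T n k                ∎
  where
  a = n C k
  b = n C suc k
  d = (n ℕ.+ k) C k
  K = + suc k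
  δ = + n - + k
  squared : ∀ K δ A B D → K * B ≡ δ * A → K * K * (B * B * D) ≡ δ * δ * (A * A * D)
  squared K δ A B D KB≡δA = begin
    K * K * (B * B * D)      ≡⟨ solve (K ∷ B ∷ D ∷ []) ⟩
    (K * B) * (K * B) * D    ≡⟨ cong (λ x → x * x * D) KB≡δA ⟩
    (δ * A) * (δ * A) * D    ≡⟨ solve (δ ∷ A ∷ D ∷ []) ⟩
    δ * δ * (A * A * D)      ∎

w-suc-ratio : ∀ n k → + suc k * + suc k * w (suc n) k ≡ + suc n * + suc (n ℕ.+ k) * T n k
w-suc-ratio n k = begin
  K * K * w (suc n) k          ≡⟨ cong (K * K *_) (pos-*³ c c f) ⟩
  K * K * (+ c * + c * + f)    ≡⟨ squared K N S (+ a) (+ c) (+ d) (+ f) (absorption n k) N*f≡S*d ⟩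
  N * S * (+ a * + a * + d)    ≡⟨ cong (N * S *_) (sym (pos-*³ a a d)) ⟩
  N * S * T n k                ∎
  where
  a = n C k
  c = suc n C suc k
  d = (n ℕ.+ k) C k
  f = suc (n ℕ.+ k) C k
  K = + suc k
  N = + suc n
  S = + suc (n ℕ.+ k)
  1+[n+k]-k≡1+n : ∀ n k → 1ℤ + (n + k) - k ≡ 1ℤ + n
  1+[n+k]-k≡1+n = solve-∀
  N*f≡S*d : N * + f ≡ S * + d
  N*f≡S*d = trans (cong (_* + f) (sym (1+[n+k]-k≡1+n (+ n) (+ k)))) ([m+1-k]*[m+1]Ck≡[m+1]*mCk (n ℕ.+ k) k)
  squared : ∀ K N S A C D F → K * C ≡ N * A → N * F ≡ S * D → K * K * (C * C * F) ≡ N * S * (A * A * D)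
  squared K N S A C D F KC≡NA NF≡SD = begin
    K * K * (C * C * F)      ≡⟨ solve (K ∷ C ∷ F ∷ []) ⟩
    (K * C) * (K * C) * F    ≡⟨ cong (λ x → x * x * F) KC≡NA ⟩
    (N * A) * (N * A) * F    ≡⟨ solve (N ∷ A ∷ F ∷ []) ⟩
    N * A * A * (N * F)      ≡⟨ cong (N * A * A *_) NF≡SD ⟩
    N * A * A * (S * D)      ≡⟨ solve (N ∷ S ∷ A ∷ D ∷ []) ⟩
    N * S * (A * A * D)      ∎

T-suc-ratio : ∀ n k →
  + suc k * + suc k * + suc k * T n (suc k) ≡ (+ n - + k) * (+ n - + k) * + suc (n ℕ.+ k) * T n k
T-suc-ratio n k = begin
  K * K * K * T n (suc k)          ≡⟨ cong (K * K * K *_) (pos-*³ b b e) ⟩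
  K * K * K * (+ b * + b * + e)    ≡⟨ cubed K δ S (+ a) (+ b) (+ d) (+ e) ([k+1]*nC[k+1]≡[n-k]*nCk n k) K*e≡S*d ⟩
  δ * δ * S * (+ a * + a * + d)    ≡⟨ cong (δ * δ * S *_) (sym (pos-*³ a a d)) ⟩
  δ * δ * S * T n k                ∎
  where
  a = n C k
  b = n C suc k
  d = (n ℕ.+ k) C k
  e = (n ℕ.+ suc k) C suc k
  K = + suc k
  S = + suc (n ℕ.+ k)
  δ = + n - + k
  K*e≡S*d : K * + e ≡ S * + d
  K*e≡S*d = trans (cong (λ m → K * + (m C suc k)) (ℕₚ.+-suc n k)) (absorption (n ℕ.+ k) k)
  cubed : ∀ K δ S A B D E → K * B ≡ δ * A → K * E ≡ S * D → K * K * K * (B * B * E) ≡ δ * δ * S * (A * A * D)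
  cubed K δ S A B D E KB≡δA KE≡SD = begin
    K * K * K * (B * B * E)          ≡⟨ solve (K ∷ B ∷ E ∷ []) ⟩
    (K * B) * (K * B) * (K * E)      ≡⟨ cong₂ (λ x y → x * x * y) KB≡δA KE≡SD ⟩
    (δ * A) * (δ * A) * (S * D)      ≡⟨ solve (δ ∷ S ∷ A ∷ D ∷ []) ⟩
    δ * δ * S * (A * A * D)          ∎

step-from-ratios : ∀ ε K δ N S t w w′ t′ a a′ c p p′ →
  K * K * w ≡ δ * δ * t → K * K * w′ ≡ N * S * t → K * K * K * t′ ≡ δ * δ * S * t →
  K * (δ * δ) * a + ε * (K * (N * S) * a′) ≡ c * (K * K * K) + p′ * (δ * δ * S) - p * (K * K * K) →
  K * K * K * (w * a + ε * (w′ * a′)) ≡ K * K * K * (c * t + (p′ * t′ - p * t))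
step-from-ratios ε K δ N S t w w′ t′ a a′ c p p′ w-rat w′-rat t′-rat cert = begin
  K * K * K * (w * a + ε * (w′ * a′))
    ≡⟨ solve (ε ∷ K ∷ w ∷ w′ ∷ a ∷ a′ ∷ []) ⟩
  K * (K * K * w) * a + ε * (K * (K * K * w′) * a′)
    ≡⟨ cong₂ (λ x y → K * x * a + ε * (K * y * a′)) w-rat w′-rat ⟩
  K * (δ * δ * t) * a + ε * (K * (N * S * t) * a′)
    ≡⟨ solve (ε ∷ K ∷ δ ∷ N ∷ S ∷ t ∷ a ∷ a′ ∷ []) ⟩
  t * (K * (δ * δ) * a + ε * (K * (N * S) * a′))
    ≡⟨ cong (t *_) cert ⟩
  t * (c * (K * K * K) + p′ * (δ * δ * S) - p * (K * K * K))
    ≡⟨ solve (K ∷ δ ∷ S ∷ t ∷ c ∷ p ∷ p′ ∷ []) ⟩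
  K * K * K * (c * t) + p′ * (δ * δ * S * t) - p * (K * K * K * t)
    ≡⟨ cong (λ x → K * K * K * (c * t) + p′ * x - p * (K * K * K * t)) (sym t′-rat) ⟩
  K * K * K * (c * t) + p′ * (K * K * K * t′) - p * (K * K * K * t)
    ≡⟨ solve (K ∷ t ∷ t′ ∷ c ∷ p ∷ p′ ∷ []) ⟩
  K * K * K * (c * t + (p′ * t′ - p * t))
    ∎

-- The pointwise relation of the WZ method divided by T n k and multiplied by (k+1)³, via the
-- three ratios above. It is written with 1ℤ + k, which is definitionally + suc k at k = + k′.
IsCertificate : (ε : ℤ) (c : ℤ → ℤ) (a P : ℤ → ℤ → ℤ) → Set
IsCertificate ε c a P = ∀ n k →
  (1ℤ + k) * ((n - k) * (n - k)) * a n k + ε * ((1ℤ + k) * ((1ℤ + n) * (1ℤ + (n + k))) * a (1ℤ + n) k)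
    ≡ c n * ((1ℤ + k) * (1ℤ + k) * (1ℤ + k))
      + P n (1ℤ + k) * ((n - k) * (n - k) * (1ℤ + (n + k)))
      - P n k * ((1ℤ + k) * (1ℤ + k) * (1ℤ + k))

module CreativeTelescoping
  (ε : ℤ) (c : ℤ → ℤ) (a P : ℤ → ℤ → ℤ)
  (P-zero : ∀ n → P n 0ℤ ≡ 0ℤ)
  (certificate : IsCertificate ε c a P)
  where

  u : ℕ → ℕ → ℤ
  u n k = w n k * a (+ n) (+ k)

  G : ℕ → ℕ → ℤ
  G n k = P (+ n) (+ k) * T n k

  pointwise : ∀ n k → u n k + ε * u (suc n) k ≡ c (+ n) * T n k + (G n (suc k) - G n k)
  pointwise n k = ℤₚ.*-cancelˡ-≡ (K * K * K) _ _
    (step-from-ratios ε K (+ n - + k) (+ suc n) (+ suc (n ℕ.+ k)) (T n k) (w n k) (w (suc n) k) (T n (suc k))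
      (a (+ n) (+ k)) (a (+ suc n) (+ k)) (c (+ n)) (P (+ n) (+ k)) (P (+ n) K)
      (w-ratio n k) (w-suc-ratio n k) (T-suc-ratio n k) (certificate (+ n) (+ k)))
    where K = + suc k

  sumTo-pointwise : ∀ n → sumTo (suc n) (λ k → u n k + ε * u (suc n) k) ≡ c (+ n) * β n
  sumTo-pointwise n = begin
    sumTo (suc n) (λ k → u n k + ε * u (suc n) k)
      ≡⟨ sumTo-cong (suc n) (λ {k} _ → pointwise n k) ⟩
    sumTo (suc n) (λ k → c (+ n) * T n k + (G n (suc k) - G n k))
      ≡⟨ sumTo-distrib-+ (suc n) (λ k → c (+ n) * T n k) (λ k → G n (suc k) - G n k) ⟩
    sumTo (suc n) (λ k → c (+ n) * T n k) + sumTo (suc n) (λ k → G n (suc k) - G n k)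
      ≡⟨ cong₂ _+_ (sumTo-*ˡ (suc n) (c (+ n)) (T n)) (sumTo-telescope (suc n) (G n)) ⟩
    c (+ n) * β n + (G n (suc n) - G n 0)
      ≡⟨ cong₂ (λ x y → c (+ n) * β n + (x - y)) G-top G-bottom ⟩
    c (+ n) * β n + 0ℤ
      ≡⟨ ℤₚ.+-identityʳ (c (+ n) * β n) ⟩
    c (+ n) * β n
      ∎
    where
    G-top : G n (suc n) ≡ 0ℤ
    G-top = trans (cong (P (+ n) (+ suc n) *_) (T-above-diagonal n)) (ℤₚ.*-zeroʳ (P (+ n) (+ suc n)))
    G-bottom : G n 0 ≡ 0ℤ
    G-bottom = trans (cong (_* T n 0) (P-zero (+ n))) (ℤₚ.*-zeroˡ (T n 0))

  Σu : ℕ → ℤ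
  Σu n = sumTo n (u n)

  recurrence : ∀ n → Σu n + ε * Σu (suc n) ≡ c (+ n) * β n
  recurrence n = begin
    Σu n + ε * Σu (suc n)
      ≡⟨ cong (_+ ε * Σu (suc n)) (sym extend) ⟩
    sumTo (suc n) (u n) + ε * Σu (suc n)
      ≡⟨ cong (λ x → sumTo (suc n) (u n) + x) (sym (sumTo-*ˡ (suc n) ε (u (suc n)))) ⟩
    sumTo (suc n) (u n) + sumTo (suc n) (λ k → ε * u (suc n) k)
      ≡⟨ sym (sumTo-distrib-+ (suc n) (u n) (λ k → ε * u (suc n) k)) ⟩
    sumTo (suc n) (λ k → u n k + ε * u (suc n) k)
      ≡⟨ sumTo-pointwise n ⟩
    c (+ n) * β n
      ∎
    where
    extend : sumTo (suc n) (u n) ≡ Σu n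
    extend = trans (cong (λ x → Σu n + x * a (+ n) (+ n)) (w-diagonal n)) (ℤₚ.+-identityʳ (Σu n))

-- a₁ n k is a₁ᶻ (+ n) (+ k) definitionally; the INLINE pragmas let the ring solver see the
-- polynomials behind these names.
a₁ᶻ a₂ᶻ a₃ᶻ : ℤ → ℤ → ℤ
a₁ᶻ n k = n * n * n - n * n * k - n * k * k - + 2 * n * n - + 5 * n * k + k * k - + 4 * n + + 2 * k + 1ℤ
a₂ᶻ n k = n * (+ 3 * n - k - 1ℤ)
a₃ᶻ n k = + 4 * n * n * n - + 2 * n * n * k - n * k * k - + 4 * n * n - + 3 * n * k + k * k - + 2 * n + + 2 * k + 1ℤ

c₁ c₂ c₃ : ℤ → ℤ
c₁ k = + 11 * k * k + + 13 * k + + 4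
c₂ k = + 11 * k * k + + 9 * k + + 2
c₃ k = + 11 * k * k * k + + 7 * k * k + - 1ℤ

P₁ P₂ P₃ : ℤ → ℤ → ℤ
P₁ n k = - (k * ((+ 3 * k + + 2) * n - k * k - + 2 * k))
P₂ n k = k * (+ 6 * n + + 3 + k)
P₃ n k = k * (+ 8 * n * n + + 4 * n + k * k + + 2 * k + + 2)

{-# INLINE a₁ᶻ #-}
{-# INLINE a₂ᶻ #-}
{-# INLINE a₃ᶻ #-}
{-# INLINE c₁ #-}
{-# INLINE c₂ #-}
{-# INLINE c₃ #-}
{-# INLINE P₁ #-}
{-# INLINE P₂ #-}
{-# INLINE P₃ #-}

P₁-certifies : IsCertificate (- 1ℤ) c₁ a₁ᶻ P₁
P₁-certifies = solve-∀

P₂-certifies : IsCertificate 1ℤ c₂ a₂ᶻ P₂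
P₂-certifies = solve-∀

P₃-certifies : IsCertificate 1ℤ c₃ a₃ᶻ P₃
P₃-certifies = solve-∀

P₁-zero : ∀ n → P₁ n 0ℤ ≡ 0ℤ
P₁-zero = solve-∀

P₂-zero : ∀ n → P₂ n 0ℤ ≡ 0ℤ
P₂-zero = solve-∀

P₃-zero : ∀ n → P₃ n 0ℤ ≡ 0ℤ
P₃-zero = solve-∀

module Identity₁ = CreativeTelescoping (- 1ℤ) c₁ a₁ᶻ P₁ P₁-zero P₁-certifies
module Identity₂ = CreativeTelescoping 1ℤ c₂ a₂ᶻ P₂ P₂-zero P₂-certifies
module Identity₃ = CreativeTelescoping 1ℤ c₃ a₃ᶻ P₃ P₃-zero P₃-certifies

lemma2p1 : (n : ℕ) → n > 0 →
    (sumTo n (λ k → (+ 11 * + k * + k + + 13 * + k + + 4) * β k)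
      ≡ - sumTo n (λ k → w n k * a₁ n k))
    × (sumTo n (λ k → (+ 11 * + k * + k + + 9 * + k + + 2) * sgn (n ∸ 1 ∸ k) * β k)
      ≡ sumTo n (λ k → w n k * a₂ n k))
    × (sumTo n (λ k → (+ 11 * + k * + k * + k + + 7 * + k * + k + - 1ℤ) * sgn (n ∸ 1 ∸ k) * β k)
      ≡ sumTo n (λ k → w n k * a₃ n k))
-- The identities hold for n = 0 as well.
lemma2p1 n _ =
    sumTo-of-differences Identity₁.Σu (λ k → c₁ (+ k) * β k) refl Identity₁.recurrence n
  , alternating-sumTo-of-sums Identity₂.Σu (λ k → c₂ (+ k)) β refl Identity₂.recurrence n
  , alternating-sumTo-of-sums Identity₃.Σu (λ k → c₃ (+ k)) β refl Identity₃.recurrence n
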